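{- Let $T=(V,E)$ be a rooted tree of unbounded degree and $p:V\to\{0,1,2\}$ such that either (i) $\#(T,p)>2$, or (ii) $\#(T,p)=2$ and $p(v)\le 1$ for all $v\in V$. Then there is a node $v$ such that either (1) $\#(T\setminus T_v,p)\le\frac{2}{3}\#(T,p)$ and $\#(T_v,p)\le\frac{2}{3}\#(T,p)$, or (2) $\#(T\setminus T_v,p)\le\frac{1}{3}\#(T,p)$ and $\#(T_u,p)\le\frac{1}{3}\#(T,p)$ for every child $u$ of $v$.
   Context: $p$ assigns to each node a number of pebbles; for a subtree or subgraph $T'$, $\#(T',p)=\sum_{v\in T'}p(v)$. $T_v$ denotes the subtree of $T$ rooted at $v$, and $T\setminus T_v$ the tree with the nodes of $T_v$ removed. -}

module Defs where

open import Data.Nat using (ℕ; zero; suc; _+_)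
open import Data.Fin using (Fin; toℕ)
open import Data.List using (List; []; _∷_)

-- A finite rooted tree with arbitrary (unbounded) branching, where every node
-- carries its pebble count p(v) ∈ {0,1,2} (an element of Fin 3).
data Tree : Set where
  node : Fin 3 → List Tree → Tree

label : Tree → Fin 3
label (node a _) = a

children : Tree → List Tree
children (node _ ts) = ts

-- Nodes of a tree, given as positions (paths from the root).
mutual
  data Pos : Tree → Set where
    here  : ∀ {t} → Pos t
    child : ∀ {a ts} → PosL ts → Pos (node a ts)

  data PosL : List Tree → Set where
    hd : ∀ {t ts} → Pos t → PosL (t ∷ ts)
    tl : ∀ {t ts} → PosL ts → PosL (t ∷ ts)

mutual
  subtree : (t : Tree) → Pos t → Tree
  subtree t here = t
  subtree (node a ts) (child p) = subtreeL ts p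

  subtreeL : (ts : List Tree) → PosL ts → Tree
  subtreeL (t ∷ ts) (hd p) = subtree t p
  subtreeL (t ∷ ts) (tl p) = subtreeL ts p

mutual
  weight : Tree → ℕ
  weight (node a ts) = toℕ a + weightL ts

  weightL : List Tree → ℕ
  weightL [] = 0
  weightL (t ∷ ts) = weight t + weightL ts

mutual
  weightOutside : (t : Tree) → Pos t → ℕ
  weightOutside t here = 0
  weightOutside (node a ts) (child p) = toℕ a + weightOutsideL ts p

  weightOutsideL : (ts : List Tree) → PosL ts → ℕ
  weightOutsideL (t ∷ ts) (hd p) = weightOutside t p + weightL ts
  weightOutsideL (t ∷ ts) (tl p) = weight t + weightOutsideL ts p

-- Walk down from the root, keeping the invariant that the pebbles outside the current
-- subtree number at most W/3, where W = #(T,p). If no child of the current node carries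
-- more than W/3, the node satisfies (2). Otherwise take such a heavy child u: if
-- #(T_u) ≤ 2W/3 then u satisfies (1), since its complement has weight below 2W/3; and if
-- #(T_u) > 2W/3 then everything outside T_u weighs less than W/3, so we descend into u.
-- The argument never uses the hypotheses (i)/(ii) on T.
module Submission where

open import Defs
open import Data.Nat using (ℕ; _+_; _*_; _≤_; _<_; _≤?_; z≤n)
open import Data.Nat.Properties
  using (+-assoc; +-comm; +-identityʳ; *-distribˡ-+; +-monoʳ-<; +-cancelʳ-<; <⇒≤; ≰⇒>;
         +-commutativeSemigroup)
open import Algebra.Properties.CommutativeSemigroup +-commutativeSemigroup using (x∙yz≈xz∙y)
open import Data.Fin using (toℕ)
open import Data.Product using (Σ; _×_; _,_)
open import Data.Sum using (_⊎_; inj₁; inj₂)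
open import Data.List using (List; []; _∷_)
open import Data.List.Relation.Unary.All using (All; []; _∷_)
open import Relation.Binary.PropositionalEquality using (_≡_; refl; sym; trans; cong; subst; module ≡-Reasoning)
open import Relation.Nullary using (yes; no)

complement-bound : ∀ {x y W c d} → x + y ≡ W → c + d ≡ 3 * W → c < 3 * y → 3 * x ≤ d
complement-bound {x} {y} {W} {c} {d} x+y≡W c+d≡3W c<3y =
  <⇒≤ (+-cancelʳ-< c (3 * x) d (subst (3 * x + c <_) 3x+3y≡d+c (+-monoʳ-< (3 * x) c<3y)))
  where
  open ≡-Reasoning
  3x+3y≡d+c : 3 * x + 3 * y ≡ d + c
  3x+3y≡d+c = begin
    3 * x + 3 * y  ≡⟨ sym (*-distribˡ-+ 3 x y) ⟩
    3 * (x + y)    ≡⟨ cong (3 *_) x+y≡W ⟩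
    3 * W          ≡⟨ sym c+d≡3W ⟩
    c + d          ≡⟨ +-comm c d ⟩
    d + c          ∎

complement-of-heavy : ∀ x y {W} → x + y ≡ W → W < 3 * y → 3 * x ≤ 2 * W
complement-of-heavy x y x+y≡W = complement-bound {x} {y} x+y≡W refl

complement-of-very-heavy : ∀ x y {W} → x + y ≡ W → 2 * W < 3 * y → 3 * x ≤ W
complement-of-very-heavy x y {W} x+y≡W = complement-bound {x} {y} x+y≡W (+-comm (2 * W) W)

module Descent (W : ℕ) where

  Light : Tree → Set
  Light u = 3 * weight u ≤ W

  Separator : ℕ → Tree → Set
  Separator o t = (3 * o ≤ 2 * W × 3 * weight t ≤ 2 * W)
                ⊎ (3 * o ≤ W × All Light (children t))

  mutual
    descend : (t : Tree) (o : ℕ) → 3 * o ≤ W → o + weight t ≡ W →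
              Σ (Pos t) λ v → Separator (o + weightOutside t v) (subtree t v)
    descend (node a ts) o 3o≤W o+t≡W
      with lightOrSeparatorAmong ts (o + toℕ a) (trans (+-assoc o (toℕ a) (weightL ts)) o+t≡W)
    ... | inj₁ allLight =
      here , inj₂ (subst (λ z → 3 * z ≤ W) (sym (+-identityʳ o)) 3o≤W , allLight)
    ... | inj₂ (q , sep) =
      child q , subst (λ z → Separator z (subtreeL ts q)) (+-assoc o (toℕ a) (weightOutsideL ts q)) sep

    lightOrSeparatorAmong : (ts : List Tree) (o : ℕ) → o + weightL ts ≡ W →
      All Light ts ⊎ Σ (PosL ts) λ q → Separator (o + weightOutsideL ts q) (subtreeL ts q)
    lightOrSeparatorAmong [] o _ = inj₁ []
    lightOrSeparatorAmong (u ∷ us) o o+ts≡W with 3 * weight u ≤? W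
    ... | yes light
      with lightOrSeparatorAmong us (o + weight u) (trans (+-assoc o (weight u) (weightL us)) o+ts≡W)
    ... | inj₁ allLight = inj₁ (light ∷ allLight)
    ... | inj₂ (q , sep) =
      inj₂ (tl q , subst (λ z → Separator z (subtreeL us q)) (+-assoc o (weight u) (weightOutsideL us q)) sep)
    lightOrSeparatorAmong (u ∷ us) o o+ts≡W | no heavy =
      inj₂ (separatorBelowHeavy u us o (trans (sym (x∙yz≈xz∙y o (weight u) (weightL us))) o+ts≡W) (≰⇒> heavy))

    separatorBelowHeavy : (u : Tree) (us : List Tree) (o : ℕ) →
      o + weightL us + weight u ≡ W → W < 3 * weight u →
      Σ (PosL (u ∷ us)) λ q → Separator (o + weightOutsideL (u ∷ us) q) (subtreeL (u ∷ us) q)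
    separatorBelowHeavy u us o rest+u≡W heavy with 3 * weight u ≤? 2 * W
    ... | yes notTooHeavy =
      hd here , inj₁ (complement-of-heavy (o + weightL us) (weight u) rest+u≡W heavy , notTooHeavy)
    ... | no tooHeavy
      with descend u (o + weightL us)
             (complement-of-very-heavy (o + weightL us) (weight u) rest+u≡W (≰⇒> tooHeavy)) rest+u≡W
    ... | v , sep =
      hd v , subst (λ z → Separator z (subtree u v)) (sym (x∙yz≈xz∙y o (weightOutside u v) (weightL us))) sep

lemma14 : (T : Tree) →
    (2 < weight T ⊎ (weight T ≡ 2 × ((v : Pos T) → toℕ (label (subtree T v)) ≤ 1))) →
    Σ (Pos T) (λ v →
      (3 * weightOutside T v ≤ 2 * weight T × 3 * weight (subtree T v) ≤ 2 * weight T)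
      ⊎ (3 * weightOutside T v ≤ weight T
         × All (λ u → 3 * weight u ≤ weight T) (children (subtree T v))))
lemma14 T _ = descend T 0 z≤n refl
  where open Descent (weight T)
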